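{- Let $n\ge2$. For every $J\subseteq[n-2]$, $I\subseteq[n-1]$ and $1\le k\le n$, \[|\{\pi\in R_{n-1,J}^{ -1}C_n:\ \pi^{ -1}(n)=k,\ \mathrm{Des}(\pi)=I\}|=|\{T\in\mathrm{SYT}(L_{n,J}):\ T_1=k,\ \mathrm{Des}(T)=I\}|.\]
   Context: $\mathfrak{S}_{n-1}$ is identified with the permutations in $\mathfrak{S}_n$ fixing $n$. $\mathrm{Des}(\pi)=\{i:\pi(i)>\pi(i+1)\}$; $R_{n-1,J}=\{\pi\in\mathfrak{S}_{n-1}:\mathrm{Des}(\pi)\subseteq J\}$ viewed in $\mathfrak{S}_n$, and $R_{n-1,J}^{ -1}=\{\pi^{ -1}:\pi\in R_{n-1,J}\}$. $c=(1,2,\dots,n)$, $C_n=\{c^j:0\le j<n\}$, products are compositions $(\pi\sigma)(i)=\pi(\sigma(i))$, and $AB=\{\pi\sigma:\pi\in A,\sigma\in B\}$. For $J=\{j_1<\dots<j_t\}\subseteq[n-2]$, $L_{n,J}$ is the skew shape (English notation) of size $n$ consisting of disconnected one-row strips of sizes $j_1,j_2-j_1,\dots,n-1-j_t,1$ from left to right, each strip lying one row above the previous one and touching it at a single corner point (so the strips proceed in the northeast direction, the last strip being a single box in the top row). $\mathrm{SYT}(L_{n,J})$ is its set of standard Young tableaux (entries $1,\dots,n$ increasing along rows and down columns); for such $T$, $T_1$ is the entry in its upper-right box, and $\mathrm{Des}(T)=\{i:i+1\text{ lies in a row strictly below the row of }i\}$. -}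

module Defs where

-- We write n = suc (suc m) (so n ≥ 2).  The set [N] = {1,…,N}
-- is encoded by Fin N, the element x : Fin N standing for (toℕ x + 1).
-- A map w : [p] → [q] is stored in one-line notation as a vector
-- Vec (Fin q) p with lookup w i = w(i).

import Data.Bool
open import Data.Bool using (Bool; true; false; if_then_else_)
open import Data.Nat as ℕ using (ℕ; zero; suc; _+_)
open import Data.Nat.ListAction using (sum)
open import Data.Nat.DivMod using (_mod_)
open import Data.Fin as F using (Fin; zero; suc; toℕ; inject₁; fromℕ)
open import Data.Fin.Properties as FP using (any?; all?)
open import Data.Fin.Subset using (Subset; _⊆_; ∣_∣)
open import Data.Fin.Subset.Properties using (_⊆?_)
open import Data.Vec as V using (Vec; []; _∷_; lookup; tabulate)
open import Data.Vec.Properties as VP using ()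
open import Data.List as L using (List; [_]; map; concatMap; length; filter)
open import Data.List.Membership.Propositional using () renaming (_∈_ to _∈L_)
open import Data.List.Membership.Propositional.Properties
  using (∈-allFin; ∈-map⁺; ∈-concatMap⁺)
open import Data.List.Relation.Unary.Any as Any using (Any; here; there)
open import Data.Product using (Σ; ∃; _×_; _,_; proj₁; proj₂)
open import Relation.Unary using (Decidable)
open import Relation.Nullary using (Dec; yes; no; ¬_)
open import Relation.Nullary.Decidable using (_×-dec_; _→-dec_; ⌊_⌋)
open import Relation.Binary.PropositionalEquality using (_≡_; refl; subst; sym)

words : (q p : ℕ) → List (Vec (Fin q) p)
words q zero    = [ [] ]
words q (suc p) = concatMap (λ x → map (x ∷_) (words q p)) (L.allFin q)

words-complete : ∀ {q p} (v : Vec (Fin q) p) → v ∈L words q p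
words-complete []       = here refl
words-complete {q} (x ∷ v) =
  ∈-concatMap⁺ (λ y → map (y ∷_) (words q _)) (Any.map (λ { refl → ∈-map⁺ (x ∷_) (words-complete v) }) (∈-allFin x))

∃Vec? : ∀ {q p} {P : Vec (Fin q) p → Set} → Decidable P → Dec (∃ P)
∃Vec? {q} {p} {P} P? with Any.any? P? (words q p)
... | yes a = yes (Any.satisfied a)
... | no ¬a = no λ { (v , pv) → ¬a (Any.map (λ eq → subst P eq pv) (words-complete v)) }

count : ∀ {N} {P : Vec (Fin N) N → Set} → Decidable P → ℕ
count {N} P? = length (filter P? (words N N))

-- w is a permutation of [N] (injective self-map of a finite set)
IsPerm : ∀ {N} → Vec (Fin N) N → Set
IsPerm {N} w = ∀ i j → lookup w i ≡ lookup w j → i ≡ j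

isPerm? : ∀ {N} → Decidable (IsPerm {N})
isPerm? w = all? λ i → all? λ j → (lookup w i F.≟ lookup w j) →-dec (i F.≟ j)

Des : ∀ {q p} → Vec (Fin q) (suc p) → Subset p
Des w = tabulate λ i → ⌊ lookup w (suc i) F.<? lookup w (inject₁ i) ⌋

c : ∀ {N} → Fin N → Fin N
c {suc N} i = suc (toℕ i) mod (suc N)

cpow : ∀ {N} → ℕ → Fin N → Fin N
cpow zero    i = i
cpow (suc j) i = c (cpow j i)

module _ {m : ℕ} where
  private
    n : ℕ
    n = suc (suc m)
    Perm : Set
    Perm = Vec (Fin n) n

  top : Fin n
  top = fromℕ (suc m)

  -- ρ ∈ R_{n-1,J} (viewed in S_n): ρ is a permutation of [n] fixing n,
  -- whose descent set as an element of S_{n-1} (i.e. of the word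
  -- ρ(1)…ρ(n-1)) is contained in J ⊆ [n-2]
  InR : Subset m → Perm → Set
  InR J ρ = IsPerm ρ × (lookup ρ top ≡ top)
          × (Des {n} {m} (tabulate λ i → lookup ρ (inject₁ i)) ⊆ J)

  inR? : (J : Subset m) → Decidable (InR J)
  inR? J ρ = isPerm? ρ ×-dec (lookup ρ top F.≟ top)
           ×-dec (Des {n} {m} (tabulate λ i → lookup ρ (inject₁ i)) ⊆? J)

  -- π ∈ R_{n-1,J}^{-1} C_n : π = σ c^j with σ = ρ^{-1}, ρ ∈ R_{n-1,J}, 0 ≤ j < n
  -- (σ = ρ^{-1} expressed as σ ∘ ρ = id; products are compositions)
  InRC : Subset m → Perm → Set
  InRC J π = ∃ λ (σ : Perm) → ∃ λ (ρ : Perm) →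
               InR J ρ × (∀ i → lookup σ (lookup ρ i) ≡ i)
             × ∃ λ (j : Fin n) → ∀ i → lookup π i ≡ lookup σ (cpow (toℕ j) i)

  inRC? : (J : Subset m) → Decidable (InRC J)
  inRC? J π = ∃Vec? λ σ → ∃Vec? λ ρ →
                inR? J ρ ×-dec all? (λ i → lookup σ (lookup ρ i) F.≟ i)
              ×-dec any? λ j → all? λ i → lookup π i F.≟ lookup σ (cpow (toℕ j) i)

  -- π ∈ R_{n-1,J}^{-1} C_n, π^{-1}(n) = k (i.e. π(k) = n), Des(π) = I
  PermSide : Subset m → Subset (suc m) → Fin n → Perm → Set
  PermSide J I k π = IsPerm π × InRC J π × (lookup π k ≡ top) × (Des π ≡ I)

  permSide? : (J : Subset m) (I : Subset (suc m)) (k : Fin n) → Decidable (PermSide J I k)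
  permSide? J I k π = isPerm? π ×-dec inRC? J π ×-dec (lookup π k F.≟ top)
                    ×-dec VP.≡-dec Data.Bool._≟_ (Des π) I

  private
    lt : ∀ {a b} → Fin a → Fin b → Bool
    lt i j = ⌊ toℕ i ℕ.<? toℕ j ⌋

  -- L_{n,J} has exactly one box in each column 1,…,n (English notation,
  -- rows numbered from 0 at the top, increasing downwards, columns from 0
  -- at the left).  Column x (0-based) with x+1 ≤ n-1 lies in the strip
  -- beginning after the last element of J below x+1; that strip is in row
  -- 1 + #{ j ∈ J : j ≥ x+1 }.  The box in the last column n is the
  -- one-box strip alone in the top row 0.  Hence the strips have sizes
  -- j₁, j₂-j₁, …, n-1-j_t, 1 from left to right, occupy consecutive
  -- columns, and each lies one row above the previous one, touching it at
  -- a single corner.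
  rowL : Subset m → Fin n → ℕ
  rowL J x with toℕ x ℕ.≟ suc m
  ... | yes _ = 0
  ... | no  _ = suc (sum (map (λ j → if lookup J j then (if lt j x then 0 else 1) else 0)
                                 (L.allFin m)))

  colL : Fin n → ℕ
  colL x = toℕ x

  -- A filling T of L_{n,J}: box in column x ↦ entry lookup T x ∈ [n].
  -- T is standard: bijective onto [n], increasing along rows (left to
  -- right) and down columns.
  IsSYT : Subset m → Perm → Set
  IsSYT J T = IsPerm T
    × (∀ x y → rowL J x ≡ rowL J y → colL x ℕ.< colL y → lookup T x F.< lookup T y)
    × (∀ x y → colL x ≡ colL y → rowL J x ℕ.< rowL J y → lookup T x F.< lookup T y)

  isSYT? : (J : Subset m) → Decidable (IsSYT J)
  isSYT? J T = isPerm? T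
    ×-dec all? (λ x → all? λ y → (rowL J x ℕ.≟ rowL J y) →-dec (colL x ℕ.<? colL y)
                                  →-dec (lookup T x F.<? lookup T y))
    ×-dec all? (λ x → all? λ y → (colL x ℕ.≟ colL y) →-dec (rowL J x ℕ.<? rowL J y)
                                  →-dec (lookup T x F.<? lookup T y))

  -- T₁ : the entry of the upper-right box (the top-row box, column n)
  T₁ : Perm → Fin n
  T₁ T = lookup T top

  DesT : Subset m → Perm → Subset (suc m)
  DesT J T = tabulate λ i → ⌊ any? (λ x → any? λ y →
                 (lookup T x F.≟ inject₁ i) ×-dec (lookup T y F.≟ suc i)
                 ×-dec (rowL J x ℕ.<? rowL J y)) ⌋

  SYTSide : Subset m → Subset (suc m) → Fin n → Perm → Set
  SYTSide J I k T = IsSYT J T × (T₁ T ≡ k) × (DesT J T ≡ I)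

  sytSide? : (J : Subset m) (I : Subset (suc m)) (k : Fin n) → Decidable (SYTSide J I k)
  sytSide? J I k T = isSYT? J T ×-dec (T₁ T F.≟ k) ×-dec VP.≡-dec Data.Bool._≟_ (DesT J T) I

-- Write s = n - k, the number of steps along c = (1,2,…,n) from k to n.  If π(k) = n
-- and π = σ c^j with σ⁻¹ ∈ R_{n-1,J}, then σ⁻¹(n) = n forces j = s, and the condition
-- Des(σ⁻¹) ⊆ J says that ρ = c^s π⁻¹ increases along every strip (row) of L_{n,J}:
-- π fills the columns of each strip in increasing order of the rotated key c^s.
-- Dually, T ∈ SYT(L_{n,J}) with T₁ = k is the inverse of a permutation τ with τ(k) = n
-- filling each strip in increasing order of the plain key.  For such a filling the
-- descents are exactly the i with row(π i) above row(π (i+1)): keys of consecutive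
-- letters differ by one except at k, whose column is the one-box top row.  Hence
-- re-sorting each strip from one key to the other is a bijection that keeps the row
-- of every letter, so it preserves π⁻¹(n) = k and the descent set.

module Submission where

open import Data.Bool using (true; false; if_then_else_)
import Data.Bool.Properties as Bool
open import Data.Empty using (⊥-elim)
open import Data.Fin as F using (Fin; zero; suc; toℕ; inject₁; fromℕ; fromℕ<)
open import Data.Fin.Induction using (<-weakInduction)
import Data.Fin.Properties as FP
open import Data.Fin.Relation.Unary.Top using (view; ‵fromℕ; ‵inject₁)
open import Data.Fin.Subset using (Subset; _⊆_; _∈_)
open import Data.List as L using (List; []; _∷_; map; length; filter; allFin; upTo)
import Data.List.Properties as LP
open import Data.List.Membership.Propositional using () renaming (_∈_ to _∈ₗ_)
open import Data.List.Membership.Propositional.Properties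
  using (∈-lookup; ∈-filter⁺; ∈-filter⁻; ∈-allFin; ∈-upTo⁺; ∈-map⁻)
open import Data.List.Relation.Unary.All as All using ([]; _∷_)
import Data.List.Relation.Unary.All.Properties as AllP
open import Data.List.Relation.Unary.AllPairs as AllPairs using ([]; _∷_)
import Data.List.Relation.Unary.AllPairs.Properties as AllPairsP
open import Data.List.Relation.Unary.Any as Any using (here; there)
open import Data.List.Relation.Unary.Any.Properties using (lookup-index)
open import Data.List.Relation.Unary.Unique.Propositional using (Unique)
import Data.List.Relation.Unary.Unique.Propositional.Properties as UniqueP
open import Data.Nat as ℕ using (ℕ; zero; suc; _+_; _∸_; _≤_; _<_; z≤n; s≤s)
open import Data.Nat.DivMod using (m<n⇒m%n≡m; n%n≡0)
open import Data.Nat.ListAction using (sum)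
import Data.Nat.Properties as NP
open import Data.Product using (∃; _×_; _,_; proj₁; proj₂)
open import Data.Sum using (_⊎_; inj₁; inj₂)
open import Data.Vec using (Vec; []; _∷_; lookup; tabulate)
import Data.Vec.Properties as VP
open import Function using (_∘_; id)
open import Function.Bundles using (_⇔_; mk⇔; Equivalence)
open import Function.Definitions using (Injective)
open import Relation.Binary using (tri<; tri≈; tri>)
open import Relation.Binary.PropositionalEquality
open import Relation.Nullary using (Dec; yes; no; ¬_; contradiction)
open import Relation.Nullary.Decidable using (⌊_⌋; _×-dec_; _⊎-dec_; _→-dec_; isYes≗does; does-⇔)
open import Relation.Unary using (Decidable)

open import Defs

record Correspondence {A : Set} (P Q : A → Set) : Set where
  field
    to              : A → A
    from            : A → A
    to-preserves    : ∀ x → P x → Q (to x)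
    from-preserves  : ∀ y → Q y → P (from y)
    from∘to         : ∀ x → P x → from (to x) ≡ x
    to∘from         : ∀ y → Q y → to (from y) ≡ y

lookup-injective : ∀ {A : Set} {xs : List A} → Unique xs →
                   ∀ {i j} → L.lookup xs i ≡ L.lookup xs j → i ≡ j
lookup-injective (_  ∷ _) {zero}  {zero}  _  = refl
lookup-injective (x∉ ∷ _) {zero}  {suc j} eq = ⊥-elim (All.lookup x∉ (∈-lookup j) eq)
lookup-injective (x∉ ∷ _) {suc i} {zero}  eq = ⊥-elim (All.lookup x∉ (∈-lookup i) (sym eq))
lookup-injective (_  ∷ u) {suc i} {suc j} eq = cong suc (lookup-injective u eq)

length-≤-by-injection : ∀ {A B : Set} {xs : List A} {ys : List B} (f : A → B) → Unique xs →
                        (∀ {x} → x ∈ₗ xs → f x ∈ₗ ys) →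
                        (∀ {x y} → x ∈ₗ xs → y ∈ₗ xs → f x ≡ f y → x ≡ y) →
                        length xs ≤ length ys
length-≤-by-injection {xs = xs} {ys} f xs-unique maps inj = FP.injective⇒≤ index-injective
  where
  index : Fin (length xs) → Fin (length ys)
  index i = Any.index (maps (∈-lookup i))
  index-injective : Injective _≡_ _≡_ index
  index-injective {i} {j} eq = lookup-injective xs-unique (inj (∈-lookup i) (∈-lookup j)
    (trans (lookup-index (maps (∈-lookup i)))
      (trans (cong (L.lookup ys) eq) (sym (lookup-index (maps (∈-lookup j)))))))

module _ {A : Set} {W : List A} (W-unique : Unique W) (W-complete : ∀ x → x ∈ₗ W) where

  length-filter-≤ : {P Q : A → Set} (P? : Decidable P) (Q? : Decidable Q) (f g : A → A) →
                    (∀ x → P x → Q (f x)) → (∀ x → P x → g (f x) ≡ x) →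
                    length (filter P? W) ≤ length (filter Q? W)
  length-filter-≤ {P} P? Q? f g PQ gf = length-≤-by-injection f (UniqueP.filter⁺ P? W-unique)
    (λ {x} x∈ → ∈-filter⁺ Q? (W-complete (f x)) (PQ x (satisfies x∈)))
    (λ {x} {y} x∈ y∈ eq → trans (sym (gf x (satisfies x∈))) (trans (cong g eq) (gf y (satisfies y∈))))
    where
    satisfies : ∀ {x} → x ∈ₗ filter P? W → P x
    satisfies x∈ = proj₂ (∈-filter⁻ P? {xs = W} x∈)

  length-filter-≡ : {P Q : A → Set} (P? : Decidable P) (Q? : Decidable Q) →
                    Correspondence P Q → length (filter P? W) ≡ length (filter Q? W)
  length-filter-≡ P? Q? C = NP.≤-antisym
    (length-filter-≤ P? Q? to from to-preserves from∘to)
    (length-filter-≤ Q? P? from to from-preserves to∘from)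
    where open Correspondence C

words-unique : ∀ q p → Unique (words q p)
words-unique q zero    = [] ∷ []
words-unique q (suc p) = UniqueP.concat⁺ (AllP.map⁺ (All.tabulate λ _ → prefixed-unique))
  (AllPairsP.map⁺ (AllPairs.map prefixes-disjoint (UniqueP.allFin⁺ q)))
  where
  prefixed-unique : ∀ {x} → Unique (map (x ∷_) (words q p))
  prefixed-unique = UniqueP.map⁺ (λ eq → proj₂ (VP.∷-injective eq)) (words-unique q p)
  prefixes-disjoint : ∀ {x y} → x ≢ y → ∀ {v} →
                      ¬ (v ∈ₗ map (x ∷_) (words q p) × v ∈ₗ map (y ∷_) (words q p))
  prefixes-disjoint x≢y (a , b) with ∈-map⁻ _ a | ∈-map⁻ _ b
  ... | _ , _ , refl | _ , _ , eq = x≢y (proj₁ (VP.∷-injective eq))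

count-≡ : ∀ {N} {P Q : Vec (Fin N) N → Set} (P? : Decidable P) (Q? : Decidable Q) →
          Correspondence P Q → count P? ≡ count Q?
count-≡ {N} = length-filter-≡ (words-unique N N) words-complete

countFin : ∀ {N} {P : Fin N → Set} → Decidable P → ℕ
countFin {N} P? = length (filter P? (allFin N))

module _ {N : ℕ} where

  countFin-mono : {P Q : Fin N → Set} (P? : Decidable P) (Q? : Decidable Q) →
                  (∀ x → P x → Q x) → countFin P? ≤ countFin Q?
  countFin-mono P? Q? PQ =
    length-filter-≤ (UniqueP.allFin⁺ N) ∈-allFin P? Q? id id PQ (λ _ _ → refl)

  countFin-cong : {P Q : Fin N → Set} (P? : Decidable P) (Q? : Decidable Q) →
                  (∀ x → P x → Q x) → (∀ x → Q x → P x) → countFin P? ≡ countFin Q?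
  countFin-cong P? Q? PQ QP = NP.≤-antisym (countFin-mono P? Q? PQ) (countFin-mono Q? P? QP)

  countFin-≡ : {P Q : Fin N → Set} (P? : Decidable P) (Q? : Decidable Q) →
               Correspondence P Q → countFin P? ≡ countFin Q?
  countFin-≡ = length-filter-≡ (UniqueP.allFin⁺ N) ∈-allFin

  countFin-strict : {P Q : Fin N → Set} (P? : Decidable P) (Q? : Decidable Q) →
                    (∀ x → P x → Q x) → ∀ x → Q x → ¬ P x → countFin P? < countFin Q?
  countFin-strict P? Q? PQ x qx ¬px = length-≤-by-injection id
      (All.tabulate x∉ ∷ UniqueP.filter⁺ P? (UniqueP.allFin⁺ N)) maps (λ _ _ eq → eq)
    where
    x∉ : ∀ {y} → y ∈ₗ filter P? (allFin N) → x ≢ y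
    x∉ y∈ refl = ¬px (proj₂ (∈-filter⁻ P? {xs = allFin N} y∈))
    maps : ∀ {y} → y ∈ₗ (x ∷ filter P? (allFin N)) → y ∈ₗ filter Q? (allFin N)
    maps (here refl) = ∈-filter⁺ Q? (∈-allFin x) qx
    maps {y} (there y∈) = ∈-filter⁺ Q? (∈-allFin y) (PQ y (proj₂ (∈-filter⁻ P? {xs = allFin N} y∈)))

  countFin-below : ∀ a → a ≤ N → countFin (λ (x : Fin N) → toℕ x ℕ.<? a) ≡ a
  countFin-below a a≤N = NP.≤-antisym
    (subst (countFin below? ≤_) (LP.length-upTo a)
      (length-≤-by-injection toℕ (UniqueP.filter⁺ below? (UniqueP.allFin⁺ N))
        (λ x∈ → ∈-upTo⁺ (proj₂ (∈-filter⁻ below? {xs = allFin N} x∈)))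
        (λ _ _ → FP.toℕ-injective)))
    (subst (_≤ countFin below?) (LP.length-tabulate {n = a} id)
      (length-≤-by-injection (λ i → F.inject≤ i a≤N) (UniqueP.allFin⁺ a)
        (λ {i} _ → ∈-filter⁺ below? (∈-allFin _)
          (subst (_< a) (sym (FP.toℕ-inject≤ i a≤N)) (FP.toℕ<n i)))
        (λ {i} {j} _ _ → FP.inject≤-injective a≤N a≤N i j)))
    where
    below? : Decidable (λ (x : Fin N) → toℕ x < a)
    below? x = toℕ x ℕ.<? a

  -- A down-closed subset of Fin N is the initial segment of length its size.
  module _ {D : Fin N → Set} (D? : Decidable D)
           (down-closed : ∀ {p q} → toℕ q ≤ toℕ p → D p → D q) where

    down-closed-<-countFin : ∀ p → D p → toℕ p < countFin D?
    down-closed-<-countFin p dp = NP.≤-trans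
      (NP.≤-reflexive (sym (countFin-below (suc (toℕ p)) (FP.toℕ<n p))))
      (countFin-mono _ D? (λ q q≤p → down-closed (NP.≤-pred q≤p) dp))

    down-closed-countFin-≤ : ∀ p → ¬ D p → countFin D? ≤ toℕ p
    down-closed-countFin-≤ p ¬dp = NP.≤-trans
      (countFin-mono D? (λ (x : Fin N) → toℕ x ℕ.<? toℕ p)
        (λ q dq → NP.≰⇒> (λ p≤q → ¬dp (down-closed p≤q dq))))
      (NP.≤-reflexive (countFin-below (toℕ p) (NP.<⇒≤ (FP.toℕ<n p))))

injective⇒surjective : ∀ {N} {f : Fin N → Fin N} → Injective _≡_ _≡_ f → ∀ p → ∃ λ u → f u ≡ p
injective⇒surjective {f = f} f-injective p with FP.any? (λ u → f u FP.≟ p)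
... | yes found = found
injective⇒surjective {suc M} {f} f-injective p | no missed =
  ⊥-elim (NP.<-irrefl refl (FP.injective⇒≤ f-punchOut-injective))
  where
  f-punchOut : Fin (suc M) → Fin M
  f-punchOut u = F.punchOut {i = p} {j = f u} (λ eq → missed (u , sym eq))
  f-punchOut-injective : Injective _≡_ _≡_ f-punchOut
  f-punchOut-injective {u} {v} eq = f-injective
    (FP.punchOut-injective (λ e → missed (u , sym e)) (λ e → missed (v , sym e)) eq)

module _ {N : ℕ} (f : Fin N → Fin N) where

  -- Defaults to p itself when p has no preimage, which never happens for injective f.
  preimage : Fin N → Fin N
  preimage p with FP.any? (λ u → f u FP.≟ p)
  ... | yes (u , _) = u
  ... | no _        = p

  module _ (f-injective : Injective _≡_ _≡_ f) where

    f∘preimage : ∀ p → f (preimage p) ≡ p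
    f∘preimage p with FP.any? (λ u → f u FP.≟ p)
    ... | yes (_ , fu≡p) = fu≡p
    ... | no missed      = ⊥-elim (missed (injective⇒surjective f-injective p))

    preimage∘f : ∀ u → preimage (f u) ≡ u
    preimage∘f u = f-injective (f∘preimage (f u))

    preimage-injective : Injective _≡_ _≡_ preimage
    preimage-injective {p} {q} eq = trans (sym (f∘preimage p)) (trans (cong f eq) (f∘preimage q))

countFin-reindex : ∀ {N} {P : Fin N → Set} {π : Fin N → Fin N} → Injective _≡_ _≡_ π →
                   (P? : Decidable P) → countFin (P? ∘ π) ≡ countFin P?
countFin-reindex {P = P} {π} π-injective P? = countFin-≡ (P? ∘ π) P? record
  { to             = π
  ; from           = preimage π
  ; to-preserves   = λ _ Pπx → Pπx
  ; from-preserves = λ y Py → subst P (sym (f∘preimage π π-injective y)) Py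
  ; from∘to        = λ x _ → preimage∘f π π-injective x
  ; to∘from        = λ y _ → f∘preimage π π-injective y
  }

-- Larger labels come first: row labels decrease from left to right.
module Ranking {N : ℕ} (key : Fin N → ℕ) (key-injective : Injective _≡_ _≡_ key)
               (label : Fin N → ℕ) where

  _≺_ : Fin N → Fin N → Set
  u ≺ v = label v < label u ⊎ (label u ≡ label v × key u < key v)

  _≺?_ : ∀ u v → Dec (u ≺ v)
  u ≺? v = (label v ℕ.<? label u) ⊎-dec ((label u ℕ.≟ label v) ×-dec (key u ℕ.<? key v))

  ≺-irrefl : ∀ {u} → ¬ u ≺ u
  ≺-irrefl (inj₁ lt)      = NP.<-irrefl refl lt
  ≺-irrefl (inj₂ (_ , lt)) = NP.<-irrefl refl lt

  ≺-trans : ∀ {u v w} → u ≺ v → v ≺ w → u ≺ w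
  ≺-trans     (inj₁ a)       (inj₁ b)        = inj₁ (NP.<-trans b a)
  ≺-trans {u} (inj₁ a)       (inj₂ (e , _))  = inj₁ (subst (_< label u) e a)
  ≺-trans {w = w} (inj₂ (e , _)) (inj₁ b)    = inj₁ (subst (label w <_) (sym e) b)
  ≺-trans     (inj₂ (e , a)) (inj₂ (e′ , b)) = inj₂ (trans e e′ , NP.<-trans a b)

  ≺-connex : ∀ u v → u ≢ v → u ≺ v ⊎ v ≺ u
  ≺-connex u v u≢v with NP.<-cmp (label u) (label v)
  ... | tri< a _ _ = inj₂ (inj₁ a)
  ... | tri> _ _ c = inj₁ (inj₁ c)
  ... | tri≈ _ e _ with NP.<-cmp (key u) (key v)
  ...   | tri< a _ _  = inj₁ (inj₂ (e , a))
  ...   | tri≈ _ e′ _ = ⊥-elim (u≢v (key-injective e′))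
  ...   | tri> _ _ c  = inj₂ (inj₂ (sym e , c))

  rank : Fin N → ℕ
  rank v = countFin (_≺? v)

  rank-mono : ∀ {u v} → u ≺ v → rank u < rank v
  rank-mono {u} {v} u≺v = countFin-strict (_≺? u) (_≺? v) (λ w w≺u → ≺-trans w≺u u≺v) u u≺v ≺-irrefl

  rank-reflects-≺ : ∀ {u v} → rank u < rank v → u ≺ v
  rank-reflects-≺ {u} {v} r with u FP.≟ v
  ... | yes refl = ⊥-elim (NP.<-irrefl refl r)
  ... | no u≢v with ≺-connex u v u≢v
  ...   | inj₁ u≺v = u≺v
  ...   | inj₂ v≺u = ⊥-elim (NP.<-asym r (rank-mono v≺u))

  rank-injective : Injective _≡_ _≡_ rank
  rank-injective {u} {v} e with u FP.≟ v
  ... | yes u≡v = u≡v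
  ... | no u≢v with ≺-connex u v u≢v
  ...   | inj₁ u≺v = ⊥-elim (NP.<-irrefl e (rank-mono u≺v))
  ...   | inj₂ v≺u = ⊥-elim (NP.<-irrefl (sym e) (rank-mono v≺u))

  rank<N : ∀ v → rank v < N
  rank<N v = NP.≤-trans
    (countFin-strict (_≺? v) (λ (x : Fin N) → toℕ x ℕ.<? N) (λ x _ → FP.toℕ<n x) v (FP.toℕ<n v) ≺-irrefl)
    (NP.≤-reflexive (countFin-below N NP.≤-refl))

  rankFin : Fin N → Fin N
  rankFin v = fromℕ< (rank<N v)

  toℕ-rankFin : ∀ v → toℕ (rankFin v) ≡ rank v
  toℕ-rankFin v = FP.toℕ-fromℕ< (rank<N v)

  rankFin-injective : Injective _≡_ _≡_ rankFin
  rankFin-injective {u} {v} e = rank-injective (trans (sym (toℕ-rankFin u)) (trans (cong toℕ e) (toℕ-rankFin v)))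

  rankFin-reflects-≺ : ∀ {u v} → toℕ (rankFin u) < toℕ (rankFin v) → u ≺ v
  rankFin-reflects-≺ {u} {v} r = rank-reflects-≺ (subst₂ _<_ (toℕ-rankFin u) (toℕ-rankFin v) r)

rank-cong : ∀ {N} {key : Fin N → ℕ} (key-injective : Injective _≡_ _≡_ key) {label label′ : Fin N → ℕ} →
            (∀ u → label u ≡ label′ u) →
            ∀ v → Ranking.rank key key-injective label v ≡ Ranking.rank key key-injective label′ v
rank-cong key-injective {label} {label′} eq v = countFin-cong (_≺? v) (_≺′? v) (transport eq) (transport (sym ∘ eq))
  where
  open Ranking _ key-injective label using (_≺?_)
  open Ranking _ key-injective label′ using () renaming (_≺?_ to _≺′?_)
  transport : ∀ {g g′ : Fin _ → ℕ} → (∀ u → g u ≡ g′ u) → ∀ u →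
              Ranking._≺_ _ key-injective g u v → Ranking._≺_ _ key-injective g′ u v
  transport eq u (inj₁ lt)       = inj₁ (subst₂ _<_ (eq v) (eq u) lt)
  transport eq u (inj₂ (e , lt)) = inj₂ (trans (sym (eq u)) (trans e (eq v)) , lt)

module RowSorting {N : ℕ} (row : Fin N → ℕ)
                  (row-antitone : ∀ {x y} → toℕ x ≤ toℕ y → row y ≤ row x) where

  IncreasingOnRows : (Fin N → ℕ) → Set
  IncreasingOnRows f = ∀ p q → row p ≡ row q → toℕ p < toℕ q → f p < f q

  RowSorted : (Fin N → ℕ) → (Fin N → Fin N) → Set
  RowSorted key π = ∀ u v → row (π u) ≡ row (π v) → toℕ (π u) < toℕ (π v) → key u < key v

  row-sorted⇒increasing : ∀ {key π} → Injective _≡_ _≡_ π → RowSorted key π →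
                          IncreasingOnRows (key ∘ preimage π)
  row-sorted⇒increasing {π = π} π-injective sorted p q same before =
    sorted (preimage π p) (preimage π q)
      (subst₂ (λ x y → row x ≡ row y) (sym (f∘preimage π π-injective p)) (sym (f∘preimage π π-injective q)) same)
      (subst₂ (λ x y → toℕ x < toℕ y) (sym (f∘preimage π π-injective p)) (sym (f∘preimage π π-injective q)) before)

  module _ (key : Fin N → ℕ) (key-injective : Injective _≡_ _≡_ key)
           (π : Fin N → Fin N) (π-injective : Injective _≡_ _≡_ π) where
    open Ranking key key-injective (row ∘ π)

    row-sorted⇒toℕ≡rank : RowSorted key π → ∀ v → toℕ (π v) ≡ rank v
    row-sorted⇒toℕ≡rank sorted v = begin
      toℕ (π v)                       ≡⟨ countFin-below (toℕ (π v)) (NP.<⇒≤ (FP.toℕ<n (π v))) ⟨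
      countFin before-v?              ≡⟨ countFin-reindex π-injective before-v? ⟨
      countFin (before-v? ∘ π)        ≡⟨ countFin-cong _ (_≺? v) before⇒≺ ≺⇒before ⟩
      rank v                          ∎
      where
      open ≡-Reasoning
      before-v? : Decidable (λ (x : Fin N) → toℕ x < toℕ (π v))
      before-v? x = toℕ x ℕ.<? toℕ (π v)
      before⇒≺ : ∀ u → toℕ (π u) < toℕ (π v) → u ≺ v
      before⇒≺ u lt with NP.m≤n⇒m<n∨m≡n (row-antitone (NP.<⇒≤ lt))
      ... | inj₁ higher = inj₁ higher
      ... | inj₂ same   = inj₂ (sym same , sorted u v (sym same) lt)
      ≺⇒before : ∀ u → u ≺ v → toℕ (π u) < toℕ (π v)
      ≺⇒before u (inj₁ higher) = NP.≰⇒> (λ le → NP.<⇒≱ higher (row-antitone le))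
      ≺⇒before u (inj₂ (same , lt)) with NP.<-cmp (toℕ (π u)) (toℕ (π v))
      ... | tri< before _ _ = before
      ... | tri≈ _ e _      = ⊥-elim (NP.<-irrefl (cong key (π-injective (FP.toℕ-injective e))) lt)
      ... | tri> _ _ after  = ⊥-elim (NP.<-asym lt (sorted v u (sym same) after))

    -- With b = row (π v): at most rank v positions lie in rows above b and more than rank v
    -- in rows from b upwards, and both sets of positions are initial segments.
    row-rankFin : ∀ v → row (rankFin v) ≡ row (π v)
    row-rankFin v = NP.≤-antisym (NP.≮⇒≥ not-above) (NP.≮⇒≥ (λ lt → not-below (NP.<⇒≱ lt)))
      where
      b = row (π v)
      above? : Decidable (λ p → b < row p)
      above? p = b ℕ.<? row p
      from? : Decidable (λ p → b ≤ row p)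
      from? p = b ℕ.≤? row p
      #above≤rank : countFin above? ≤ rank v
      #above≤rank = NP.≤-trans (NP.≤-reflexive (sym (countFin-reindex π-injective above?)))
                               (countFin-mono _ (_≺? v) (λ _ → inj₁))
      rank<#from : rank v < countFin from?
      rank<#from = NP.≤-trans
        (countFin-strict (_≺? v) (from? ∘ π) (λ { _ (inj₁ lt) → NP.<⇒≤ lt ; _ (inj₂ (e , _)) → NP.≤-reflexive (sym e) })
                         v NP.≤-refl ≺-irrefl)
        (NP.≤-reflexive (countFin-reindex π-injective from?))
      not-above : ¬ b < row (rankFin v)
      not-above above = NP.<-irrefl refl (NP.<-≤-trans
        (down-closed-<-countFin above? (λ le lt → NP.<-≤-trans lt (row-antitone le)) (rankFin v) above)
        (NP.≤-trans #above≤rank (NP.≤-reflexive (sym (toℕ-rankFin v)))))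
      not-below : ¬ ¬ b ≤ row (rankFin v)
      not-below below = NP.<-irrefl refl (NP.<-≤-trans
        (NP.≤-trans (s≤s (NP.≤-reflexive (toℕ-rankFin v))) rank<#from)
        (down-closed-countFin-≤ from? (λ le lt → NP.≤-trans lt (row-antitone le)) (rankFin v) below))

    rankFin-row-sorted : RowSorted key rankFin
    rankFin-row-sorted u v same before with rankFin-reflects-≺ before
    ... | inj₁ higher = ⊥-elim (NP.<-irrefl (trans (sym (row-rankFin v)) (trans (sym same) (row-rankFin u))) higher)
    ... | inj₂ (_ , lt) = lt

    rankFin-unique : RowSorted key π → ∀ {σ : Fin N → Fin N} → (∀ u → row (σ u) ≡ row (π u)) →
                     ∀ v → Ranking.rankFin key key-injective (row ∘ σ) v ≡ π v
    rankFin-unique sorted {σ} same-rows v = FP.toℕ-injective (begin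
      toℕ (Ranking.rankFin key key-injective (row ∘ σ) v) ≡⟨ Ranking.toℕ-rankFin key key-injective (row ∘ σ) v ⟩
      Ranking.rank key key-injective (row ∘ σ) v          ≡⟨ rank-cong key-injective same-rows v ⟩
      rank v                                               ≡⟨ row-sorted⇒toℕ≡rank sorted v ⟨
      toℕ (π v)                                            ∎)
      where open ≡-Reasoning

module _ {M : ℕ} (row : Fin (suc M) → ℕ) (row-antitone : ∀ {x y} → toℕ x ≤ toℕ y → row y ≤ row x)
         (f : Fin (suc M) → ℕ)
         (step : ∀ i → row (inject₁ i) ≡ row (suc i) → f (inject₁ i) ≤ f (suc i)) where

  monotone-on-rows : ∀ {p q} → toℕ p ≤ toℕ q → row p ≡ row q → f p ≤ f q
  monotone-on-rows {p} {q} = <-weakInduction P base next q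
    where
    P : Fin (suc M) → Set
    P q = toℕ p ≤ toℕ q → row p ≡ row q → f p ≤ f q
    base : P zero
    base p≤0 _ = NP.≤-reflexive (cong f (FP.toℕ-injective (NP.n≤0⇒n≡0 p≤0)))
    next : ∀ i → P (inject₁ i) → P (suc i)
    next i IH p≤1+i same with toℕ p ℕ.≤? toℕ (inject₁ i)
    ... | no  p≰i = NP.≤-reflexive (cong f (FP.toℕ-injective
                      (NP.≤-antisym p≤1+i (subst (_< toℕ p) (FP.toℕ-inject₁ i) (NP.≰⇒> p≰i)))))
    ... | yes p≤i = NP.≤-trans (IH p≤i p~i) (step i i~1+i)
      where
      i≤1+i : toℕ (inject₁ i) ≤ toℕ (suc i)
      i≤1+i = subst (_≤ suc (toℕ i)) (sym (FP.toℕ-inject₁ i)) (NP.n≤1+n _)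
      below : row (suc i) ≤ row (inject₁ i)
      below = row-antitone i≤1+i
      above : row (inject₁ i) ≤ row p
      above = row-antitone p≤i
      p~i : row p ≡ row (inject₁ i)
      p~i = NP.≤-antisym (subst (_≤ row (inject₁ i)) (sym same) below) above
      i~1+i : row (inject₁ i) ≡ row (suc i)
      i~1+i = NP.≤-antisym (subst (row (inject₁ i) ≤_) same above) below

module _ {N : ℕ} where

  c-inject₁ : (i : Fin N) → c (inject₁ i) ≡ suc i
  c-inject₁ i = FP.toℕ-injective (begin
    toℕ (c (inject₁ i))             ≡⟨ FP.toℕ-fromℕ< _ ⟩
    suc (toℕ (inject₁ i)) ℕ.% suc N ≡⟨ m<n⇒m%n≡m (s≤s (FP.inject₁ℕ< i)) ⟩
    suc (toℕ (inject₁ i))           ≡⟨ cong suc (FP.toℕ-inject₁ i) ⟩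
    suc (toℕ i)                     ∎)
    where open ≡-Reasoning

  c-fromℕ : c (fromℕ N) ≡ zero
  c-fromℕ = FP.toℕ-injective (begin
    toℕ (c (fromℕ N))             ≡⟨ FP.toℕ-fromℕ< _ ⟩
    suc (toℕ (fromℕ N)) ℕ.% suc N ≡⟨ cong (λ t → suc t ℕ.% suc N) (FP.toℕ-fromℕ N) ⟩
    suc N ℕ.% suc N               ≡⟨ n%n≡0 (suc N) ⟩
    0                             ∎)
    where open ≡-Reasoning

  toℕ-c : {x : Fin (suc N)} → x ≢ fromℕ N → toℕ (c x) ≡ suc (toℕ x)
  toℕ-c {x} x≢last with view x
  ... | ‵fromℕ     = ⊥-elim (x≢last refl)
  ... | ‵inject₁ i = trans (cong toℕ (c-inject₁ i)) (cong suc (sym (FP.toℕ-inject₁ i)))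

  c-injective : Injective _≡_ _≡_ (c {suc N})
  c-injective {x} {y} eq with view x | view y
  ... | ‵fromℕ     | ‵fromℕ     = refl
  ... | ‵fromℕ     | ‵inject₁ j = ⊥-elim (FP.0≢1+n (trans (sym c-fromℕ) (trans eq (c-inject₁ j))))
  ... | ‵inject₁ i | ‵fromℕ     = ⊥-elim (FP.0≢1+n (trans (sym c-fromℕ) (trans (sym eq) (c-inject₁ i))))
  ... | ‵inject₁ i | ‵inject₁ j =
    cong inject₁ (FP.suc-injective (trans (sym (c-inject₁ i)) (trans eq (c-inject₁ j))))

  cpow-injective : ∀ j → Injective _≡_ _≡_ (cpow {suc N} j)
  cpow-injective zero    eq = eq
  cpow-injective (suc j) eq = cpow-injective j (c-injective eq)

  cpow-c : ∀ j (x : Fin (suc N)) → cpow j (c x) ≡ c (cpow j x)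
  cpow-c zero    x = refl
  cpow-c (suc j) x = cong c (cpow-c j x)

  cpow-+ : ∀ a b (x : Fin (suc N)) → cpow (a + b) x ≡ cpow a (cpow b x)
  cpow-+ zero    b x = refl
  cpow-+ (suc a) b x = cong c (cpow-+ a b x)

  toℕ-cpow : ∀ j (x : Fin (suc N)) → toℕ x + j ≤ N → toℕ (cpow j x) ≡ toℕ x + j
  toℕ-cpow zero    x _    = sym (NP.+-identityʳ (toℕ x))
  toℕ-cpow (suc j) x x+j<N = begin
    toℕ (c (cpow j x))       ≡⟨ toℕ-c cpow-j≢last ⟩
    suc (toℕ (cpow j x))     ≡⟨ cong suc IH ⟩
    suc (toℕ x + j)          ≡⟨ NP.+-suc (toℕ x) j ⟨
    toℕ x + suc j            ∎
    where
    open ≡-Reasoning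
    x+j<N′ : toℕ x + j < N
    x+j<N′ = subst (_≤ N) (NP.+-suc (toℕ x) j) x+j<N
    IH : toℕ (cpow j x) ≡ toℕ x + j
    IH = toℕ-cpow j x (NP.<⇒≤ x+j<N′)
    cpow-j≢last : cpow j x ≢ fromℕ N
    cpow-j≢last eq = NP.<-irrefl (trans (sym IH) (trans (cong toℕ eq) (FP.toℕ-fromℕ N))) x+j<N′

  cpow-fromℕ-≢ : ∀ d → 0 < d → d ≤ N → cpow d (fromℕ N) ≢ fromℕ N
  cpow-fromℕ-≢ (suc d) _ d<N eq = NP.<-irrefl d≡N d<N
    where
    d≡N : d ≡ N
    d≡N = begin
      d                          ≡⟨ toℕ-cpow d zero (NP.<⇒≤ d<N) ⟨
      toℕ (cpow d zero)          ≡⟨ cong (toℕ ∘ cpow d) c-fromℕ ⟨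
      toℕ (cpow d (c (fromℕ N))) ≡⟨ cong toℕ (trans (cpow-c d (fromℕ N)) eq) ⟩
      toℕ (fromℕ N)              ≡⟨ FP.toℕ-fromℕ N ⟩
      N                          ∎
      where open ≡-Reasoning

  stepsToLast : Fin (suc N) → ℕ
  stepsToLast x = N ∸ toℕ x

  cpow-stepsToLast : ∀ x → cpow (stepsToLast x) x ≡ fromℕ N
  cpow-stepsToLast x = FP.toℕ-injective (begin
    toℕ (cpow (stepsToLast x) x) ≡⟨ toℕ-cpow (stepsToLast x) x (NP.≤-reflexive x+s≡N) ⟩
    toℕ x + stepsToLast x        ≡⟨ x+s≡N ⟩
    N                            ≡⟨ FP.toℕ-fromℕ N ⟨
    toℕ (fromℕ N)                ∎)
    where
    open ≡-Reasoning
    x+s≡N : toℕ x + stepsToLast x ≡ N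
    x+s≡N = NP.m+[n∸m]≡n (FP.toℕ≤pred[n] x)

  cpow-returns-to-fromℕ : ∀ {a b} x → a < b → b ≤ N →
                          cpow a x ≡ fromℕ N → cpow b x ≢ fromℕ N
  cpow-returns-to-fromℕ {a} {b} x a<b b≤N at-a at-b = cpow-fromℕ-≢ (b ∸ a)
    (NP.m<n⇒0<n∸m a<b) (NP.≤-trans (NP.m∸n≤m b a) b≤N) (begin
      cpow (b ∸ a) (fromℕ N)   ≡⟨ cong (cpow (b ∸ a)) at-a ⟨
      cpow (b ∸ a) (cpow a x)  ≡⟨ cpow-+ (b ∸ a) a x ⟨
      cpow (b ∸ a + a) x       ≡⟨ cong (λ t → cpow t x) (NP.m∸n+n≡m (NP.<⇒≤ a<b)) ⟩
      cpow b x                 ≡⟨ at-b ⟩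
      fromℕ N                  ∎)
    where open ≡-Reasoning

  cpow≡fromℕ⇒stepsToLast : ∀ {j} x → j ≤ N → cpow j x ≡ fromℕ N → j ≡ stepsToLast x
  cpow≡fromℕ⇒stepsToLast {j} x j≤N eq with NP.<-cmp j (stepsToLast x)
  ... | tri≈ _ j≡s _ = j≡s
  ... | tri< j<s _ _ = ⊥-elim (cpow-returns-to-fromℕ x j<s (NP.m∸n≤m N (toℕ x)) eq (cpow-stepsToLast x))
  ... | tri> _ _ s<j = ⊥-elim (cpow-returns-to-fromℕ x s<j j≤N (cpow-stepsToLast x) eq)

sum-map-mono : ∀ {A : Set} {f g : A → ℕ} → (∀ x → f x ≤ g x) → ∀ xs → sum (map f xs) ≤ sum (map g xs)
sum-map-mono f≤g []       = z≤n
sum-map-mono f≤g (x ∷ xs) = NP.+-mono-≤ (f≤g x) (sum-map-mono f≤g xs)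

sum-map-mono-< : ∀ {A : Set} {f g : A → ℕ} → (∀ x → f x ≤ g x) → ∀ {xs y} → y ∈ₗ xs → f y < g y →
                 sum (map f xs) < sum (map g xs)
sum-map-mono-< f≤g {x ∷ xs} (here refl) lt = NP.+-mono-<-≤ lt (sum-map-mono f≤g xs)
sum-map-mono-< f≤g {x ∷ xs} (there y∈)  lt = NP.+-mono-≤-< (f≤g x) (sum-map-mono-< f≤g y∈ lt)

module Rows {m : ℕ} (J : Subset m) where

  jumpAt : ℕ → Fin m → ℕ
  jumpAt a j = if lookup J j then (if ⌊ toℕ j ℕ.<? a ⌋ then 0 else 1) else 0

  -- #{ j ∈ J : j ≥ a } in the 0-based encoding; jumpAt is literally the summand of rowL,
  -- so column a < n - 1 lies in row 1 + jumpsFrom a by computation.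
  jumpsFrom : ℕ → ℕ
  jumpsFrom a = sum (map (jumpAt a) (allFin m))

  jumpAt-antitone : ∀ {a b} → a ≤ b → ∀ j → jumpAt b j ≤ jumpAt a j
  jumpAt-antitone {a} {b} a≤b j with lookup J j
  ... | false = z≤n
  ... | true with toℕ j ℕ.<? a | toℕ j ℕ.<? b
  ...   | yes _   | yes _   = z≤n
  ...   | yes j<a | no  j≮b = ⊥-elim (j≮b (NP.<-≤-trans j<a a≤b))
  ...   | no  _   | yes _   = z≤n
  ...   | no  _   | no  _   = NP.≤-refl

  jumpsFrom-antitone : ∀ {a b} → a ≤ b → jumpsFrom b ≤ jumpsFrom a
  jumpsFrom-antitone a≤b = sum-map-mono (jumpAt-antitone a≤b) (allFin m)

  jumpsFrom-∉ : (i : Fin m) → lookup J i ≡ false → jumpsFrom (toℕ i) ≡ jumpsFrom (suc (toℕ i))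
  jumpsFrom-∉ i i∉J = cong sum (LP.map-cong same-jump (allFin m))
    where
    same-jump : ∀ j → jumpAt (toℕ i) j ≡ jumpAt (suc (toℕ i)) j
    same-jump j with j FP.≟ i
    ... | yes refl rewrite i∉J = refl
    ... | no j≢i with lookup J j
    ...   | false = refl
    ...   | true with toℕ j ℕ.<? toℕ i | toℕ j ℕ.<? suc (toℕ i)
    ...     | yes _   | yes _    = refl
    ...     | yes j<i | no  j≮1+i = ⊥-elim (j≮1+i (NP.m<n⇒m<1+n j<i))
    ...     | no  j≮i | yes j<1+i = ⊥-elim (j≢i (FP.toℕ-injective (NP.≤-antisym (NP.≤-pred j<1+i) (NP.≮⇒≥ j≮i))))
    ...     | no  _   | no  _    = refl

  jumpsFrom-∈ : (i : Fin m) → lookup J i ≡ true → jumpsFrom (suc (toℕ i)) < jumpsFrom (toℕ i)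
  jumpsFrom-∈ i i∈J = sum-map-mono-< (jumpAt-antitone (NP.n≤1+n _)) (∈-allFin i) jump-at-i
    where
    jump-at-i : jumpAt (suc (toℕ i)) i < jumpAt (toℕ i) i
    jump-at-i rewrite i∈J with toℕ i ℕ.<? toℕ i | toℕ i ℕ.<? suc (toℕ i)
    ... | yes i<i | _       = ⊥-elim (NP.<-irrefl refl i<i)
    ... | no  _   | yes _   = s≤s z≤n
    ... | no  _   | no  i≮i+1 = ⊥-elim (i≮i+1 NP.≤-refl)

  rowL-top : rowL J top ≡ 0
  rowL-top with toℕ (top {m}) ℕ.≟ suc m
  ... | yes _  = refl
  ... | no  ne = ⊥-elim (ne (FP.toℕ-fromℕ (suc m)))

  rowL-inject₁ : (i : Fin (suc m)) → rowL J (inject₁ i) ≡ suc (jumpsFrom (toℕ i))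
  rowL-inject₁ i with toℕ (inject₁ i) ℕ.≟ suc m
  ... | yes eq = ⊥-elim (NP.<-irrefl eq (FP.inject₁ℕ< i))
  ... | no  _  = cong (suc ∘ jumpsFrom) (FP.toℕ-inject₁ i)

  rowL-antitone : ∀ {x y : Fin (suc (suc m))} → toℕ x ≤ toℕ y → rowL J y ≤ rowL J x
  rowL-antitone {x} {y} x≤y with view y
  ... | ‵fromℕ     = subst (_≤ rowL J x) (sym rowL-top) z≤n
  ... | ‵inject₁ j with view x
  ...   | ‵fromℕ     = ⊥-elim (NP.<-irrefl refl (NP.<-≤-trans (FP.inject₁ℕ< j)
                         (subst (_≤ toℕ (inject₁ j)) (FP.toℕ-fromℕ (suc m)) x≤y)))
  ...   | ‵inject₁ i = subst₂ _≤_ (sym (rowL-inject₁ j)) (sym (rowL-inject₁ i))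
                         (s≤s (jumpsFrom-antitone (subst₂ _≤_ (FP.toℕ-inject₁ i) (FP.toℕ-inject₁ j) x≤y)))

  rowL≡0⇒top : ∀ x → rowL J x ≡ 0 → x ≡ top
  rowL≡0⇒top x row≡0 with view x
  ... | ‵fromℕ     = refl
  ... | ‵inject₁ i = ⊥-elim (NP.0≢1+n (trans (sym row≡0) (rowL-inject₁ i)))

  rowL-step-last : rowL J (inject₁ (fromℕ m)) ≢ rowL J top
  rowL-step-last eq = NP.0≢1+n (trans (sym rowL-top) (trans (sym eq) (rowL-inject₁ (fromℕ m))))

  rowL-step-∉ : (i : Fin m) → lookup J i ≡ false → rowL J (inject₁ (inject₁ i)) ≡ rowL J (suc (inject₁ i))
  rowL-step-∉ i i∉J = begin
    rowL J (inject₁ (inject₁ i))      ≡⟨ rowL-inject₁ (inject₁ i) ⟩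
    suc (jumpsFrom (toℕ (inject₁ i))) ≡⟨ cong (suc ∘ jumpsFrom) (FP.toℕ-inject₁ i) ⟩
    suc (jumpsFrom (toℕ i))           ≡⟨ cong suc (jumpsFrom-∉ i i∉J) ⟩
    suc (jumpsFrom (suc (toℕ i)))     ≡⟨ rowL-inject₁ (suc i) ⟨
    rowL J (suc (inject₁ i))          ∎
    where open ≡-Reasoning

  rowL-step-∈ : (i : Fin m) → lookup J i ≡ true → rowL J (suc (inject₁ i)) < rowL J (inject₁ (inject₁ i))
  rowL-step-∈ i i∈J = subst₂ _<_ (sym (rowL-inject₁ (suc i)))
    (sym (trans (rowL-inject₁ (inject₁ i)) (cong (suc ∘ jumpsFrom) (FP.toℕ-inject₁ i))))
    (s≤s (jumpsFrom-∈ i i∈J))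

⌊⌋-⇔ : ∀ {A B : Set} (a? : Dec A) (b? : Dec B) → A ⇔ B → ⌊ a? ⌋ ≡ ⌊ b? ⌋
⌊⌋-⇔ a? b? A⇔B = trans (isYes≗does a?) (trans (does-⇔ A⇔B a? b?) (sym (isYes≗does b?)))

⌊⌋≡true⇒ : ∀ {A : Set} (a? : Dec A) → ⌊ a? ⌋ ≡ true → A
⌊⌋≡true⇒ (yes a) _ = a

⇒⌊⌋≡true : ∀ {A : Set} (a? : Dec A) → A → ⌊ a? ⌋ ≡ true
⇒⌊⌋≡true (yes _) _ = refl
⇒⌊⌋≡true (no ¬a) a = ⊥-elim (¬a a)

module _ {q p : ℕ} (w : Vec (Fin q) (suc p)) where

  lookup-Des : ∀ i → lookup (Des w) i ≡ ⌊ lookup w (suc i) F.<? lookup w (inject₁ i) ⌋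
  lookup-Des = VP.lookup∘tabulate _

  ∈-Des⁻ : ∀ {i} → i ∈ Des w → lookup w (suc i) F.< lookup w (inject₁ i)
  ∈-Des⁻ {i} i∈ = ⌊⌋≡true⇒ _ (trans (sym (lookup-Des i)) (VP.[]=⇒lookup i∈))

  ∈-Des⁺ : ∀ {i} → lookup w (suc i) F.< lookup w (inject₁ i) → i ∈ Des w
  ∈-Des⁺ {i} descent = VP.lookup⇒[]= i (Des w) (trans (lookup-Des i) (⇒⌊⌋≡true _ descent))

Des-cong : ∀ {q p} {w w′ : Vec (Fin q) (suc p)} →
           (∀ i → (lookup w (suc i) F.< lookup w (inject₁ i)) ⇔ (lookup w′ (suc i) F.< lookup w′ (inject₁ i))) →
           Des w ≡ Des w′
Des-cong same = VP.tabulate-cong λ i → ⌊⌋-⇔ _ _ (same i)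

inverse : ∀ {N} → Vec (Fin N) N → Vec (Fin N) N
inverse τ = tabulate (preimage (lookup τ))

lookup-inverse : ∀ {N} (τ : Vec (Fin N) N) p → lookup (inverse τ) p ≡ preimage (lookup τ) p
lookup-inverse τ = VP.lookup∘tabulate _

module _ {N} (τ : Vec (Fin N) N) (τ-perm : IsPerm τ) where

  private
    τ-injective : Injective _≡_ _≡_ (lookup τ)
    τ-injective = τ-perm _ _

  inverseˡ : ∀ p → lookup τ (lookup (inverse τ) p) ≡ p
  inverseˡ p = trans (cong (lookup τ) (lookup-inverse τ p)) (f∘preimage _ τ-injective p)

  inverseʳ : ∀ u → lookup (inverse τ) (lookup τ u) ≡ u
  inverseʳ u = trans (lookup-inverse τ _) (preimage∘f _ τ-injective u)

  inverse-isPerm : IsPerm (inverse τ)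
  inverse-isPerm p q eq = trans (sym (inverseˡ p)) (trans (cong (lookup τ) eq) (inverseˡ q))

  inverse-involutive : inverse (inverse τ) ≡ τ
  inverse-involutive = trans (VP.tabulate-cong preimage-inverse) (VP.tabulate∘lookup τ)
    where
    preimage-inverse : ∀ u → preimage (lookup (inverse τ)) u ≡ lookup τ u
    preimage-inverse u = trans (cong (preimage (lookup (inverse τ))) (sym (inverseʳ u)))
                               (preimage∘f _ (inverse-isPerm _ _) (lookup τ u))

-- Permutations sorted along the strips of L_{n,J}

module _ {m : ℕ} (J : Subset m) (k : Fin (suc (suc m))) where

  private
    n : ℕ
    n = suc (suc m)
    Perm : Set
    Perm = Vec (Fin n) n

  open Rows J
  open RowSorting (rowL J) rowL-antitone

  record Key : Set where
    field
      key       : Fin n → ℕ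
      injective : Injective _≡_ _≡_ key
      step      : ∀ (i : Fin (suc m)) → inject₁ i ≢ k → key (suc i) ≡ suc (key (inject₁ i))

  toℕ-key : Key
  toℕ-key = record
    { key       = toℕ
    ; injective = FP.toℕ-injective
    ; step      = λ i _ → cong suc (sym (FP.toℕ-inject₁ i))
    }

  cyclic-key : Key
  cyclic-key = record
    { key       = toℕ ∘ cpow s
    ; injective = cpow-injective s ∘ FP.toℕ-injective
    ; step      = step
    }
    where
    s = stepsToLast k
    step : ∀ (i : Fin (suc m)) → inject₁ i ≢ k → toℕ (cpow s (suc i)) ≡ suc (toℕ (cpow s (inject₁ i)))
    step i i≢k = begin
      toℕ (cpow s (suc i))             ≡⟨ cong (toℕ ∘ cpow s) (c-inject₁ i) ⟨
      toℕ (cpow s (c (inject₁ i)))     ≡⟨ cong toℕ (cpow-c s (inject₁ i)) ⟩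
      toℕ (c (cpow s (inject₁ i)))     ≡⟨ toℕ-c not-last ⟩
      suc (toℕ (cpow s (inject₁ i)))   ∎
      where
      open ≡-Reasoning
      not-last : cpow s (inject₁ i) ≢ fromℕ (suc m)
      not-last eq = i≢k (cpow-injective s (trans eq (sym (cpow-stepsToLast k))))

  module _ (κ : Key) {π : Fin n → Fin n} (π-injective : Injective _≡_ _≡_ π) (π-k : π k ≡ top)
           (sorted : RowSorted (Key.key κ) π) where
    open Key κ

    -- Consecutive letters have consecutive keys except at k, and k goes to the one-box top row.
    descent⇔row-increase : ∀ i → (π (suc i) F.< π (inject₁ i)) ⇔ (rowL J (π (inject₁ i)) < rowL J (π (suc i)))
    descent⇔row-increase i = mk⇔ to from
      where
      from : rowL J (π (inject₁ i)) < rowL J (π (suc i)) → π (suc i) F.< π (inject₁ i)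
      from higher = NP.≰⇒> (λ le → NP.<⇒≱ higher (rowL-antitone le))
      to : π (suc i) F.< π (inject₁ i) → rowL J (π (inject₁ i)) < rowL J (π (suc i))
      to descent with NP.m≤n⇒m<n∨m≡n (rowL-antitone (NP.<⇒≤ descent))
      ... | inj₁ higher = higher
      ... | inj₂ same   = ⊥-elim (NP.<-asym (sorted (suc i) (inject₁ i) (sym same) descent)
                                             (NP.≤-reflexive (sym (step i i≢k))))
        where
        i≢k : inject₁ i ≢ k
        i≢k refl = NP.<-irrefl (cong toℕ (trans suc-i-top (sym π-k))) descent
          where
          suc-i-top : π (suc i) ≡ top
          suc-i-top = rowL≡0⇒top _ (trans (sym same) (trans (cong (rowL J) π-k) rowL-top))

  RowSortedSide : Key → Subset (suc m) → Perm → Set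
  RowSortedSide κ I π = IsPerm π × lookup π k ≡ top × RowSorted (Key.key κ) (lookup π) × Des π ≡ I

  rowSortedSide? : ∀ κ I → Decidable (RowSortedSide κ I)
  rowSortedSide? κ I π = isPerm? π ×-dec (lookup π k F.≟ top)
    ×-dec FP.all? (λ u → FP.all? λ v → (rowL J (lookup π u) ℕ.≟ rowL J (lookup π v)) →-dec
              (toℕ (lookup π u) ℕ.<? toℕ (lookup π v)) →-dec (Key.key κ u ℕ.<? Key.key κ v))
    ×-dec VP.≡-dec Bool._≟_ (Des π) I

  Des-determined-by-rows : ∀ κ κ′ {I} (π τ : Perm) → RowSortedSide κ I π →
                           IsPerm τ → lookup τ k ≡ top → RowSorted (Key.key κ′) (lookup τ) →
                           (∀ u → rowL J (lookup τ u) ≡ rowL J (lookup π u)) → Des τ ≡ Des π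
  Des-determined-by-rows κ κ′ π τ (π-perm , π-k , π-sorted , _) τ-perm τ-k τ-sorted same-rows =
    Des-cong {w = τ} {π} λ i → mk⇔
      (λ d → Equivalence.from (π-descent i) (subst₂ _<_ (same-rows (inject₁ i)) (same-rows (suc i))
                                               (Equivalence.to (τ-descent i) d)))
      (λ d → Equivalence.from (τ-descent i) (subst₂ _<_ (sym (same-rows (inject₁ i))) (sym (same-rows (suc i)))
                                               (Equivalence.to (π-descent i) d)))
    where
    π-descent = descent⇔row-increase κ (π-perm _ _) π-k π-sorted
    τ-descent = descent⇔row-increase κ′ (τ-perm _ _) τ-k τ-sorted

  sortRows : Key → Perm → Perm
  sortRows κ π = tabulate (Ranking.rankFin (Key.key κ) (Key.injective κ) (rowL J ∘ lookup π))

  module _ (κ : Key) (π : Perm) (π-perm : IsPerm π) where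
    private
      open Key κ
      open Ranking key injective (rowL J ∘ lookup π)

      lookup-sortRows : ∀ v → lookup (sortRows κ π) v ≡ rankFin v
      lookup-sortRows = VP.lookup∘tabulate _

    sortRows-rows : ∀ v → rowL J (lookup (sortRows κ π) v) ≡ rowL J (lookup π v)
    sortRows-rows v = trans (cong (rowL J) (lookup-sortRows v)) (row-rankFin key injective (lookup π) (π-perm _ _) v)

    sortRows-isPerm : IsPerm (sortRows κ π)
    sortRows-isPerm u v eq = rankFin-injective (trans (sym (lookup-sortRows u)) (trans eq (lookup-sortRows v)))

    sortRows-sorted : RowSorted key (lookup (sortRows κ π))
    sortRows-sorted u v same before = rankFin-row-sorted key injective (lookup π) (π-perm _ _) u v
      (subst₂ (λ x y → rowL J x ≡ rowL J y) (lookup-sortRows u) (lookup-sortRows v) same)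
      (subst₂ (λ x y → toℕ x < toℕ y) (lookup-sortRows u) (lookup-sortRows v) before)

    sortRows-k : lookup π k ≡ top → lookup (sortRows κ π) k ≡ top
    sortRows-k π-k = rowL≡0⇒top _ (trans (sortRows-rows k) (trans (cong (rowL J) π-k) rowL-top))

  sortRows-fixes-sorted : ∀ κ (π : Perm) → IsPerm π → RowSorted (Key.key κ) (lookup π) →
                          ∀ σ → (∀ u → rowL J (lookup σ u) ≡ rowL J (lookup π u)) → sortRows κ σ ≡ π
  sortRows-fixes-sorted κ π π-perm sorted σ same-rows =
    trans (VP.tabulate-cong (rankFin-unique key injective (lookup π) (π-perm _ _) sorted same-rows))
          (VP.tabulate∘lookup π)
    where open Key κ

  resort : ∀ κ κ′ I → Correspondence (RowSortedSide κ I) (RowSortedSide κ′ I)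
  resort κ κ′ I = record
    { to             = sortRows κ′
    ; from           = sortRows κ
    ; to-preserves   = preserves κ κ′
    ; from-preserves = preserves κ′ κ
    ; from∘to        = λ π (π-perm , _ , sorted , _) →
                         sortRows-fixes-sorted κ π π-perm sorted (sortRows κ′ π) (sortRows-rows κ′ π π-perm)
    ; to∘from        = λ τ (τ-perm , _ , sorted , _) →
                         sortRows-fixes-sorted κ′ τ τ-perm sorted (sortRows κ τ) (sortRows-rows κ τ τ-perm)
    }
    where
    preserves : ∀ κ κ′ π → RowSortedSide κ I π → RowSortedSide κ′ I (sortRows κ′ π)
    preserves κ κ′ π side@(π-perm , π-k , _ , Des≡I) =
      τ-perm , τ-k , τ-sorted ,
      trans (Des-determined-by-rows κ κ′ π τ side τ-perm τ-k τ-sorted (sortRows-rows κ′ π π-perm)) Des≡I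
      where
      τ = sortRows κ′ π
      τ-perm   = sortRows-isPerm κ′ π π-perm
      τ-k      = sortRows-k κ′ π π-perm π-k
      τ-sorted = sortRows-sorted κ′ π π-perm

  module _ (ρ : Perm) where
    private
      prefix : Vec (Fin n) (suc m)
      prefix = tabulate λ i → lookup ρ (inject₁ i)

      lookup-prefix : ∀ i → lookup prefix i ≡ lookup ρ (inject₁ i)
      lookup-prefix = VP.lookup∘tabulate (lookup ρ ∘ inject₁)

      prefix-descent⁻ : ∀ {i} → i ∈ Des prefix →
                        lookup ρ (suc (inject₁ i)) F.< lookup ρ (inject₁ (inject₁ i))
      prefix-descent⁻ {i} i∈ = subst₂ F._<_ (lookup-prefix (suc i)) (lookup-prefix (inject₁ i)) (∈-Des⁻ prefix i∈)

      prefix-descent⁺ : ∀ {i} → lookup ρ (suc (inject₁ i)) F.< lookup ρ (inject₁ (inject₁ i)) →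
                        i ∈ Des prefix
      prefix-descent⁺ {i} d = ∈-Des⁺ prefix
        (subst₂ F._<_ (sym (lookup-prefix (suc i))) (sym (lookup-prefix (inject₁ i))) d)

    Des⊆J⇒increasing : IsPerm ρ → Des prefix ⊆ J → IncreasingOnRows (toℕ ∘ lookup ρ)
    Des⊆J⇒increasing ρ-perm Des⊆J p q same p<q = NP.≤∧≢⇒<
      (monotone-on-rows (rowL J) rowL-antitone (toℕ ∘ lookup ρ) ascent (NP.<⇒≤ p<q) same)
      (λ eq → NP.<⇒≢ p<q (cong toℕ (ρ-perm p q (FP.toℕ-injective eq))))
      where
      ascent : ∀ j → rowL J (inject₁ j) ≡ rowL J (suc j) → toℕ (lookup ρ (inject₁ j)) ≤ toℕ (lookup ρ (suc j))
      ascent j same-row with view j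
      ... | ‵fromℕ     = ⊥-elim (rowL-step-last same-row)
      ... | ‵inject₁ i with lookup J i in i∈?
      ...   | true  = ⊥-elim (NP.<-irrefl (sym same-row) (rowL-step-∈ i i∈?))
      ...   | false = NP.≮⇒≥ λ d → contradiction (trans (sym i∈?) (VP.[]=⇒lookup (Des⊆J (prefix-descent⁺ d)))) λ ()

    increasing⇒Des⊆J : IncreasingOnRows (toℕ ∘ lookup ρ) → Des prefix ⊆ J
    increasing⇒Des⊆J increasing {i} i∈Des with lookup J i in i∈?
    ... | true  = VP.lookup⇒[]= i J i∈?
    ... | false = ⊥-elim (NP.<-asym (prefix-descent⁻ i∈Des)
                    (increasing _ _ (rowL-step-∉ i i∈?) (FP.≤̄⇒inject₁< NP.≤-refl)))

  inRC⇒rowSorted : ∀ (π : Perm) → lookup π k ≡ top → InRC J π → RowSorted (Key.key cyclic-key) (lookup π)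
  inRC⇒rowSorted π π-k (σ , ρ , (ρ-perm , ρ-top , Des⊆J) , σ∘ρ , j , π≡σ∘cʲ) u v same before =
    subst₂ _<_ (key≡ u) (key≡ v) (Des⊆J⇒increasing ρ ρ-perm Des⊆J (lookup π u) (lookup π v) same before)
    where
    ρ⁻¹ = preimage (lookup ρ)
    ρ∘σ : ∀ x → lookup ρ (lookup σ x) ≡ x
    ρ∘σ x = begin
      lookup ρ (lookup σ x)                  ≡⟨ cong (lookup ρ ∘ lookup σ) (f∘preimage _ (ρ-perm _ _) x) ⟨
      lookup ρ (lookup σ (lookup ρ (ρ⁻¹ x))) ≡⟨ cong (lookup ρ) (σ∘ρ (ρ⁻¹ x)) ⟩
      lookup ρ (ρ⁻¹ x)                       ≡⟨ f∘preimage _ (ρ-perm _ _) x ⟩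
      x                                      ∎
      where open ≡-Reasoning
    cʲ≡ρ∘π : ∀ x → cpow (toℕ j) x ≡ lookup ρ (lookup π x)
    cʲ≡ρ∘π x = trans (sym (ρ∘σ _)) (cong (lookup ρ) (sym (π≡σ∘cʲ x)))
    j≡s : toℕ j ≡ stepsToLast k
    j≡s = cpow≡fromℕ⇒stepsToLast k (FP.toℕ≤pred[n] j) (trans (cʲ≡ρ∘π k) (trans (cong (lookup ρ) π-k) ρ-top))
    key≡ : ∀ x → toℕ (lookup ρ (lookup π x)) ≡ toℕ (cpow (stepsToLast k) x)
    key≡ x = cong toℕ (trans (sym (cʲ≡ρ∘π x)) (cong (λ t → cpow t x) j≡s))

  -- π = σ c^s with ρ = σ⁻¹ = c^s π⁻¹.
  rowSorted⇒inRC : ∀ (π : Perm) → IsPerm π → lookup π k ≡ top → RowSorted (Key.key cyclic-key) (lookup π) →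
                   InRC J π
  rowSorted⇒inRC π π-perm π-k sorted =
    σ , ρ , (ρ-perm , ρ-top , increasing⇒Des⊆J ρ ρ-increasing) , σ∘ρ , fromℕ< s<n , π≡σ∘cˢ
    where
    s = stepsToLast k
    π⁻¹ = preimage (lookup π)
    c⁻ˢ = preimage (cpow s)
    π-injective : Injective _≡_ _≡_ (lookup π)
    π-injective = π-perm _ _
    ρ σ : Perm
    ρ = tabulate (cpow s ∘ π⁻¹)
    σ = tabulate (lookup π ∘ c⁻ˢ)
    lookup-ρ : ∀ p → lookup ρ p ≡ cpow s (π⁻¹ p)
    lookup-ρ = VP.lookup∘tabulate _
    lookup-σ : ∀ x → lookup σ x ≡ lookup π (c⁻ˢ x)
    lookup-σ = VP.lookup∘tabulate _
    ρ-perm : IsPerm ρ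
    ρ-perm p q eq = preimage-injective _ π-injective
      (cpow-injective s (trans (sym (lookup-ρ p)) (trans eq (lookup-ρ q))))
    ρ-top : lookup ρ top ≡ top
    ρ-top = begin
      lookup ρ top              ≡⟨ lookup-ρ top ⟩
      cpow s (π⁻¹ top)          ≡⟨ cong (cpow s ∘ π⁻¹) π-k ⟨
      cpow s (π⁻¹ (lookup π k)) ≡⟨ cong (cpow s) (preimage∘f _ π-injective k) ⟩
      cpow s k                  ≡⟨ cpow-stepsToLast k ⟩
      top                       ∎
      where open ≡-Reasoning
    ρ-increasing : IncreasingOnRows (toℕ ∘ lookup ρ)
    ρ-increasing p q same before = subst₂ _<_ (cong toℕ (sym (lookup-ρ p))) (cong toℕ (sym (lookup-ρ q)))
      (row-sorted⇒increasing π-injective sorted p q same before)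
    σ∘ρ : ∀ p → lookup σ (lookup ρ p) ≡ p
    σ∘ρ p = begin
      lookup σ (lookup ρ p)           ≡⟨ lookup-σ _ ⟩
      lookup π (c⁻ˢ (lookup ρ p))     ≡⟨ cong (lookup π ∘ c⁻ˢ) (lookup-ρ p) ⟩
      lookup π (c⁻ˢ (cpow s (π⁻¹ p))) ≡⟨ cong (lookup π) (preimage∘f _ (cpow-injective s) (π⁻¹ p)) ⟩
      lookup π (π⁻¹ p)                ≡⟨ f∘preimage _ π-injective p ⟩
      p                               ∎
      where open ≡-Reasoning
    s<n : s < n
    s<n = s≤s (NP.m∸n≤m (suc m) (toℕ k))
    π≡σ∘cˢ : ∀ x → lookup π x ≡ lookup σ (cpow (toℕ (fromℕ< s<n)) x)
    π≡σ∘cˢ x = begin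
      lookup π x                           ≡⟨ cong (lookup π) (preimage∘f _ (cpow-injective s) x) ⟨
      lookup π (c⁻ˢ (cpow s x))            ≡⟨ lookup-σ _ ⟨
      lookup σ (cpow s x)                  ≡⟨ cong (λ t → lookup σ (cpow t x)) (FP.toℕ-fromℕ< s<n) ⟨
      lookup σ (cpow (toℕ (fromℕ< s<n)) x) ∎
      where open ≡-Reasoning

  permSide≅rowSortedSide : ∀ I → Correspondence (PermSide J I k) (RowSortedSide cyclic-key I)
  permSide≅rowSortedSide I = record
    { to             = id
    ; from           = id
    ; to-preserves   = λ π (π-perm , inRC , π-k , Des≡I) → π-perm , π-k , inRC⇒rowSorted π π-k inRC , Des≡I
    ; from-preserves = λ π (π-perm , π-k , sorted , Des≡I) →
                         π-perm , rowSorted⇒inRC π π-perm π-k sorted , π-k , Des≡I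
    ; from∘to        = λ _ _ → refl
    ; to∘from        = λ _ _ → refl
    }

  DesT-inverse : ∀ (τ : Perm) → IsPerm τ → lookup τ k ≡ top → RowSorted toℕ (lookup τ) →
                 DesT J (inverse τ) ≡ Des τ
  DesT-inverse τ τ-perm τ-k sorted = VP.tabulate-cong λ i →
    ⌊⌋-⇔ (rises? i) (lookup τ (suc i) F.<? lookup τ (inject₁ i)) (mk⇔ (to i) (from i))
    where
    T = inverse τ
    Rises : Fin (suc m) → Set
    Rises i = ∃ λ x → ∃ λ y → lookup T x ≡ inject₁ i × lookup T y ≡ suc i × rowL J x < rowL J y
    rises? : ∀ i → Dec (Rises i)
    rises? i = FP.any? λ x → FP.any? λ y →
      (lookup T x F.≟ inject₁ i) ×-dec (lookup T y F.≟ suc i) ×-dec (rowL J x ℕ.<? rowL J y)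
    descent = descent⇔row-increase toℕ-key (τ-perm _ _) τ-k sorted
    τ∘T : ∀ {x p} → lookup T x ≡ p → x ≡ lookup τ p
    τ∘T {x} eq = trans (sym (inverseˡ τ τ-perm x)) (cong (lookup τ) eq)
    to : ∀ i → Rises i → lookup τ (suc i) F.< lookup τ (inject₁ i)
    to i (x , y , Tx , Ty , higher) =
      Equivalence.from (descent i) (subst₂ (λ a b → rowL J a < rowL J b) (τ∘T Tx) (τ∘T Ty) higher)
    from : ∀ i → lookup τ (suc i) F.< lookup τ (inject₁ i) → Rises i
    from i d = lookup τ (inject₁ i) , lookup τ (suc i) , inverseʳ τ τ-perm _ , inverseʳ τ τ-perm _ ,
               Equivalence.to (descent i) d

  rowSortedSide≅sytSide : ∀ I → Correspondence (RowSortedSide toℕ-key I) (SYTSide J I k)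
  rowSortedSide≅sytSide I = record
    { to             = inverse
    ; from           = inverse
    ; to-preserves   = to-preserves
    ; from-preserves = from-preserves
    ; from∘to        = λ _ side → inverse-involutive _ (proj₁ side)
    ; to∘from        = λ _ side → inverse-involutive _ (proj₁ (proj₁ side))
    }
    where
    to-preserves : ∀ τ → RowSortedSide toℕ-key I τ → SYTSide J I k (inverse τ)
    to-preserves τ (τ-perm , τ-k , sorted , Des≡I) =
      (inverse-isPerm τ τ-perm , rows , columns) ,
      trans (cong (lookup (inverse τ)) (sym τ-k)) (inverseʳ τ τ-perm k) ,
      trans (DesT-inverse τ τ-perm τ-k sorted) Des≡I
      where
      rows : ∀ x y → rowL J x ≡ rowL J y → colL x < colL y → lookup (inverse τ) x F.< lookup (inverse τ) y
      rows x y same before = subst₂ (λ a b → toℕ a < toℕ b) (sym (lookup-inverse τ x)) (sym (lookup-inverse τ y))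
        (row-sorted⇒increasing (τ-perm _ _) sorted x y same before)
      columns : ∀ x y → colL x ≡ colL y → rowL J x < rowL J y → lookup (inverse τ) x F.< lookup (inverse τ) y
      columns x y same-column higher = ⊥-elim (NP.<-irrefl (cong (rowL J) (FP.toℕ-injective same-column)) higher)
    from-preserves : ∀ T → SYTSide J I k T → RowSortedSide toℕ-key I (inverse T)
    from-preserves T ((T-perm , rows , _) , T₁≡k , DesT≡I) = inverse-isPerm T T-perm , τ-k , sorted ,
      trans (sym (DesT-inverse (inverse T) (inverse-isPerm T T-perm) τ-k sorted))
            (trans (cong (DesT J) (inverse-involutive T T-perm)) DesT≡I)
      where
      τ-k : lookup (inverse T) k ≡ top
      τ-k = trans (cong (lookup (inverse T)) (sym T₁≡k)) (inverseʳ T T-perm top)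
      sorted : RowSorted toℕ (lookup (inverse T))
      sorted u v same before = subst₂ (λ a b → toℕ a < toℕ b) (inverseˡ T T-perm u) (inverseˡ T T-perm v)
        (rows _ _ same before)

lemma7p3 : (m : ℕ) (J : Subset m) (I : Subset (suc m)) (k : Fin (suc (suc m))) →
    count (permSide? J I k) ≡ count (sytSide? J I k)
lemma7p3 m J I k = begin
  count (permSide? J I k)                       ≡⟨ count-≡ _ _ (permSide≅rowSortedSide J k I) ⟩
  count (rowSortedSide? J k (cyclic-key J k) I) ≡⟨ count-≡ _ _ (resort J k (cyclic-key J k) (toℕ-key J k) I) ⟩
  count (rowSortedSide? J k (toℕ-key J k) I)    ≡⟨ count-≡ _ _ (rowSortedSide≅sytSide J k I) ⟩
  count (sytSide? J I k)                        ∎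
  where open ≡-Reasoning
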